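{- Let $G$ be a graph containing no subgraph isomorphic to $C_6$, let $x\in V(G)$, and let $A$ be a connected component of $G[N_2(x)]$. Then at least one of the following holds: (1) $|V(A)|=1$; (2) $|N(x)\cap N(V(A))|=1$; (3) $A$ is isomorphic to $K_{1,r}$ for some $r\ge 1$.
   Context: Graphs are finite, simple, undirected. For a nonempty set $S$ of vertices, $N(S)$ is the set of vertices at distance exactly $1$ from $S$; $N(x)=N(\{x\})$; $N_2(x)$ is the set of vertices at distance exactly $2$ from $x$. "No subgraph isomorphic to $C_6$" refers to not necessarily induced subgraphs. -}

module Defs where

open import Data.Nat using (ℕ; zero; suc)
open import Data.Bool using (Bool; true; false; T; _∧_; _∨_; not)
open import Data.Fin using (Fin; zero; suc)
open import Data.Fin.Subset using (Subset; _∈_; _∉_; ∣_∣)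
open import Data.Vec using (Vec; tabulate; lookup)
open import Data.List using (List; foldr; map)
open import Data.List.Base using (allFin)
open import Data.Product using (Σ; _×_; _,_; ∃)
open import Data.Sum using (_⊎_)
open import Relation.Nullary using (¬_)
open import Relation.Binary.PropositionalEquality using (_≡_; _≢_)

record Graph (n : ℕ) : Set where
  field
    adj    : Fin n → Fin n → Bool
    sym    : ∀ u v → adj u v ≡ adj v u
    irrefl : ∀ v → adj v v ≡ false

  Adj : Fin n → Fin n → Set
  Adj u v = T (adj u v)

open Graph public

anyV : {n : ℕ} → (Fin n → Bool) → Bool
anyV {n} p = foldr _∨_ false (map p (allFin n))

-- G contains a (not necessarily induced) subgraph isomorphic to C₆:
-- six pairwise distinct vertices v₀ … v₅ with vᵢ ~ vᵢ₊₁ (indices mod 6).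
ContainsC6 : {n : ℕ} → Graph n → Set
ContainsC6 {n} G =
  Σ (Fin 6 → Fin n) λ v →
    (∀ i j → v i ≡ v j → i ≡ j) ×
    (Adj G (v zero) (v (suc zero)) ×
     Adj G (v (suc zero)) (v (suc (suc zero))) ×
     Adj G (v (suc (suc zero))) (v (suc (suc (suc zero)))) ×
     Adj G (v (suc (suc (suc zero)))) (v (suc (suc (suc (suc zero))))) ×
     Adj G (v (suc (suc (suc (suc zero))))) (v (suc (suc (suc (suc (suc zero)))))) ×
     Adj G (v (suc (suc (suc (suc (suc zero)))))) (v zero))

InN2 : {n : ℕ} → Graph n → Fin n → Fin n → Set
InN2 G x v = v ≢ x × ¬ Adj G x v × ∃ λ w → Adj G x w × Adj G w v

-- Walks inside a vertex set S (i.e. walks in the induced subgraph G[S]).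
data WalkIn {n : ℕ} (G : Graph n) (S : Subset n) : Fin n → Fin n → Set where
  here : ∀ {u} → u ∈ S → WalkIn G S u u
  step : ∀ {u w v} → u ∈ S → Adj G u w → WalkIn G S w v → WalkIn G S u v

-- A is (the vertex set of) a connected component of G[N₂(x)]:
-- nonempty, contained in N₂(x), connected in G[A], and maximal
-- (closed under adjacency inside N₂(x)).
IsComponentN2 : {n : ℕ} → Graph n → Fin n → Subset n → Set
IsComponentN2 {n} G x A =
  (∃ λ a → a ∈ A) ×
  (∀ v → v ∈ A → InN2 G x v) ×
  (∀ u v → u ∈ A → v ∈ A → WalkIn G A u v) ×
  (∀ u v → u ∈ A → Adj G u v → InN2 G x v → v ∈ A)

memb : {n : ℕ} → Subset n → Fin n → Bool
memb A v = lookup A v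

Nbhd : {n : ℕ} → Graph n → Subset n → Subset n
Nbhd G S = tabulate λ y → not (memb S y) ∧ anyV (λ a → memb S a ∧ adj G a y)

NxNA : {n : ℕ} → Graph n → Fin n → Subset n → Subset n
NxNA G x A = tabulate λ y → adj G x y ∧ lookup (Nbhd G A) y

StarAdj : {r : ℕ} → Fin (suc r) → Fin (suc r) → Set
StarAdj i j = (i ≡ zero × j ≢ zero) ⊎ (j ≡ zero × i ≢ zero)

InducedIsoStar : {n : ℕ} → Graph n → Subset n → ℕ → Set
InducedIsoStar {n} G A r =
  Σ (Fin (suc r) → Fin n) λ f →
    (∀ i → f i ∈ A) ×
    (∀ i j → f i ≡ f j → i ≡ j) ×
    (∀ v → v ∈ A → ∃ λ i → f i ≡ v) ×
    (∀ i j → (Adj G (f i) (f j) → StarAdj i j) × (StarAdj i j → Adj G (f i) (f j)))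

-- Call y a *parent* of u ∈ A if y is a
-- common neighbour of x and u; N(x) ∩ N(A) is exactly the set of parents of
-- vertices of A.  Forbidding C₆ forces parents to coincide along short paths:
--   * the two ends p, q of a path p–m–q in A have the same parent, since
--     otherwise x y p m q y' is a C₆;
--   * the two middle vertices q, r of a path p–q–r–s in A have the same
--     parent, since otherwise α q p β r s is a C₆.
-- Call v ∈ A a *P₃-end* if v is the end of a path v–m–t in G[A].  If every
-- vertex is a P₃-end, the two facts above show that adjacent vertices share
-- their (unique) parent, so by connectivity all of A has a single parent and
-- |N(x) ∩ N(A)| = 1.  Otherwise some v ∈ A is no P₃-end: every neighbour of v
-- in A is a leaf, so by connectivity G[A] is a star centred at v, which has at
-- least one leaf unless |A| = 1.
module Submission where

open import Defs
open import Data.Nat as Nat using (ℕ; _≥_; s≤s; z≤n)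
open import Data.Fin using (Fin; zero; suc; _≟_)
open import Data.Fin.Properties using (any?)
open import Data.Fin.Subset using (Subset; ∣_∣; _∈_; _∉_; ⁅_⁆)
open import Data.Fin.Subset.Properties using (_∈?_; ⊆-antisym; x∈⁅x⁆; x∈⁅y⁆⇒x≡y; ∣⁅x⁆∣≡1)
open import Data.Bool using (Bool; true; false; T; not; _∧_)
open import Data.Bool.Properties using (T-∧; T-≡)
open import Data.Vec using (tabulate; lookup)
open import Data.Vec.Properties using (lookup∘tabulate; []=⇒lookup; lookup⇒[]=)
open import Data.List as List using (List; []; _∷_; length; filter; allFin)
open import Data.List.Membership.Propositional using (lose) renaming (_∈_ to _∈ˡ_)
open import Data.List.Membership.Propositional.Properties using (∈-filter⁺; ∈-filter⁻; ∈-lookup; ∈-allFin)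
open import Data.List.Relation.Unary.Any as Any using (satisfied)
open import Data.List.Relation.Unary.Any.Properties using (lookup-index; any⁺; any⁻)
open import Data.List.Relation.Unary.All as All using ([]; _∷_)
open import Data.List.Relation.Unary.AllPairs using ([]; _∷_)
open import Data.List.Relation.Unary.Unique.Propositional using (Unique)
open import Data.List.Relation.Unary.Unique.Propositional.Properties using (allFin⁺; filter⁺)
open import Data.Product using (Σ; _×_; _,_; proj₁; proj₂; ∃)
open import Data.Sum using (_⊎_; inj₁; inj₂)
open import Data.Empty using (⊥-elim)
open import Function.Bundles using (_⇔_; mk⇔; Equivalence)
open import Relation.Nullary using (¬_; Dec; yes; no)
open import Relation.Nullary.Decidable using (T?; ¬?; _×-dec_; decidable-stable)
open import Relation.Binary.PropositionalEquality as ≡ using (_≡_; _≢_; refl; trans; subst; cong; ≢-sym)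

open Equivalence using (to; from)

lookup-injective : ∀ {A : Set} {xs : List A} → Unique xs →
                   ∀ i j → List.lookup xs i ≡ List.lookup xs j → i ≡ j
lookup-injective (_ ∷ _) zero zero _ = refl
lookup-injective (fresh ∷ _) zero (suc j) e = ⊥-elim (All.lookup fresh (∈-lookup j) e)
lookup-injective (fresh ∷ _) (suc i) zero e = ⊥-elim (All.lookup fresh (∈-lookup i) (≡.sym e))
lookup-injective (_ ∷ uniq) (suc i) (suc j) e = cong suc (lookup-injective uniq i j e)

∈⇔T : ∀ {m} {S : Subset m} {y} → y ∈ S ⇔ T (lookup S y)
∈⇔T {S = S} {y} = mk⇔ (λ y∈S → from T-≡ ([]=⇒lookup y∈S))
                      (λ t → lookup⇒[]= y S (to T-≡ t))

∉⇒T-not : ∀ {m} {S : Subset m} {y} → y ∉ S → T (not (lookup S y))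
∉⇒T-not {S = S} {y} y∉S with lookup S y in eq
... | true  = ⊥-elim (y∉S (lookup⇒[]= y S eq))
... | false = _

∈-tabulate⇔ : ∀ {m} {f : Fin m → Bool} {y} → y ∈ tabulate f ⇔ T (f y)
∈-tabulate⇔ {f = f} {y} =
  mk⇔ (λ y∈ → subst T (lookup∘tabulate f y) (to ∈⇔T y∈))
      (λ t → from ∈⇔T (subst T (≡.sym (lookup∘tabulate f y)) t))

anyV⇔ : ∀ {m} {p : Fin m → Bool} → T (anyV p) ⇔ ∃ λ z → T (p z)
anyV⇔ {m} {p} = mk⇔ (λ t → satisfied (any⁻ p (allFin m) t))
                    (λ (z , pz) → any⁺ p (lose (∈-allFin z) pz))

singleton-or-other : ∀ {m} (S : Subset m) {a} → a ∈ S → ∣ S ∣ ≡ 1 ⊎ ∃ λ b → b ∈ S × b ≢ a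
singleton-or-other S {a} a∈S with any? (λ b → (b ∈? S) ×-dec ¬? (b ≟ a))
... | yes other = inj₂ other
... | no none = inj₁ (trans (cong ∣_∣ S≡⁅a⁆) (∣⁅x⁆∣≡1 a))
  where
  only-a : ∀ {z} → z ∈ S → z ≡ a
  only-a {z} z∈S = decidable-stable (z ≟ a) (λ z≢a → none (z , z∈S , z≢a))

  S≡⁅a⁆ : S ≡ ⁅ a ⁆
  S≡⁅a⁆ = ⊆-antisym (λ z∈S → subst (λ c → _ ∈ ⁅ c ⁆) (only-a z∈S) (x∈⁅x⁆ _))
                    (λ z∈⁅a⁆ → subst (_∈ S) (≡.sym (x∈⁅y⁆⇒x≡y a z∈⁅a⁆)) a∈S)

module _ {n : ℕ} (G : Graph n) where

  adj-irrefl : ∀ {u v} → Adj G u v → u ≢ v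
  adj-irrefl {u} uv refl = subst T (irrefl G u) uv

  adj-sym : ∀ {u v} → Adj G u v → Adj G v u
  adj-sym {u} {v} uv = subst T (sym G u v) uv

  walk-start : ∀ {S u v} → WalkIn G S u v → u ∈ S
  walk-start (here u∈S) = u∈S
  walk-start (step u∈S _ _) = u∈S

  cycle⇒C6 : ∀ {v₀ v₁ v₂ v₃ v₄ v₅} → Unique (v₀ ∷ v₁ ∷ v₂ ∷ v₃ ∷ v₄ ∷ v₅ ∷ []) →
    Adj G v₀ v₁ → Adj G v₁ v₂ → Adj G v₂ v₃ → Adj G v₃ v₄ → Adj G v₄ v₅ → Adj G v₅ v₀ →
    ContainsC6 G
  cycle⇒C6 {v₀} {v₁} {v₂} {v₃} {v₄} {v₅} distinct e₀₁ e₁₂ e₂₃ e₃₄ e₄₅ e₅₀ =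
    List.lookup (v₀ ∷ v₁ ∷ v₂ ∷ v₃ ∷ v₄ ∷ v₅ ∷ []) , lookup-injective distinct ,
    e₀₁ , e₁₂ , e₂₃ , e₃₄ , e₄₅ , e₅₀

  ∈Nbhd⇔ : ∀ {S y} → y ∈ Nbhd G S ⇔ T (not (memb S y) ∧ anyV (λ a → memb S a ∧ adj G a y))
  ∈Nbhd⇔ = ∈-tabulate⇔

  ∈NxNA⇔ : ∀ {x A y} → y ∈ NxNA G x A ⇔ T (adj G x y ∧ lookup (Nbhd G A) y)
  ∈NxNA⇔ = ∈-tabulate⇔

  ∈NxNA⁺ : ∀ {x A y a} → Adj G x y → y ∉ A → a ∈ A → Adj G a y → y ∈ NxNA G x A
  ∈NxNA⁺ {x} {A} {y} {a} xy y∉A a∈A ay =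
    from (∈NxNA⇔ {x} {A}) (from T-∧ (xy , to (∈⇔T {S = Nbhd G A}) y∈N[A]))
    where
    y∈N[A] : y ∈ Nbhd G A
    y∈N[A] = from (∈Nbhd⇔ {A}) (from T-∧ (∉⇒T-not y∉A ,
               from (anyV⇔ {p = λ a → memb A a ∧ adj G a y})
                    (a , from T-∧ (to (∈⇔T {S = A}) a∈A , ay))))

  ∈NxNA⁻ : ∀ {x A y} → y ∈ NxNA G x A → Adj G x y × ∃ λ a → a ∈ A × Adj G a y
  ∈NxNA⁻ {x} {A} {y} y∈ with to T-∧ (to (∈NxNA⇔ {x} {A}) y∈)
  ... | xy , y∈N[A] with to (anyV⇔ {p = λ a → memb A a ∧ adj G a y})
                            (proj₂ (to T-∧ (to (∈Nbhd⇔ {A}) (from (∈⇔T {S = Nbhd G A}) y∈N[A]))))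
  ...   | a , t = xy , a , from (∈⇔T {S = A}) (proj₁ (to T-∧ t)) , proj₂ (to T-∧ t)

  P3End : Subset n → Fin n → Set
  P3End A v = ∃ λ m → ∃ λ t → m ∈ A × t ∈ A × Adj G v m × Adj G m t × t ≢ v

  P3End? : ∀ A v → Dec (P3End A v)
  P3End? A v = any? λ m → any? λ t →
    (m ∈? A) ×-dec (t ∈? A) ×-dec T? (adj G v m) ×-dec T? (adj G m t) ×-dec ¬? (t ≟ v)

module Parents {n : ℕ} (G : Graph n) (noC6 : ¬ ContainsC6 G) (x : Fin n) (A : Subset n)
               (A⊆N₂ : ∀ v → v ∈ A → InN2 G x v) where

  Parent : Fin n → Fin n → Set
  Parent y u = Adj G x y × Adj G y u

  parent-exists : ∀ {u} → u ∈ A → ∃ λ y → Parent y u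
  parent-exists {u} u∈A = proj₂ (proj₂ (A⊆N₂ u u∈A))

  x∉A : ∀ {p} → p ∈ A → x ≢ p
  x∉A {p} p∈A x≡p = proj₁ (A⊆N₂ p p∈A) (≡.sym x≡p)

  N[x]∉A : ∀ {y p} → Adj G x y → p ∈ A → y ≢ p
  N[x]∉A {p = p} xy p∈A refl = proj₁ (proj₂ (A⊆N₂ p p∈A)) xy

  parent∈NxNA : ∀ {y a} → a ∈ A → Parent y a → y ∈ NxNA G x A
  parent∈NxNA a∈A (xy , ya) = ∈NxNA⁺ G xy (λ y∈A → N[x]∉A xy y∈A refl) a∈A (adj-sym G ya)

  NxNA⇒parent : ∀ {y} → y ∈ NxNA G x A → ∃ λ a → a ∈ A × Parent y a
  NxNA⇒parent y∈ with ∈NxNA⁻ G y∈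
  ... | xy , a , a∈A , ay = a , a∈A , xy , adj-sym G ay

  -- The ends of a path p–m–q in A share their parent: else x y p m q y' is a C₆.
  ends-share-parent : ∀ {p m q y y'} → p ∈ A → m ∈ A → q ∈ A →
    Adj G p m → Adj G m q → p ≢ q → Parent y p → Parent y' q → y ≡ y'
  ends-share-parent {y = y} {y'} p∈A m∈A q∈A pm mq p≢q (xy , yp) (xy' , y'q) =
    decidable-stable (y ≟ y') λ y≢y' → noC6 (cycle⇒C6 G
      ( (adj-irrefl G xy ∷ x∉A p∈A ∷ x∉A m∈A ∷ x∉A q∈A ∷ adj-irrefl G xy' ∷ [])
      ∷ (N[x]∉A xy p∈A ∷ N[x]∉A xy m∈A ∷ N[x]∉A xy q∈A ∷ y≢y' ∷ [])
      ∷ (adj-irrefl G pm ∷ p≢q ∷ ≢-sym (N[x]∉A xy' p∈A) ∷ [])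
      ∷ (adj-irrefl G mq ∷ ≢-sym (N[x]∉A xy' m∈A) ∷ [])
      ∷ (≢-sym (N[x]∉A xy' q∈A) ∷ [])
      ∷ [] ∷ [])
      xy yp pm mq (adj-sym G y'q) (adj-sym G xy'))

  -- By the
  -- previous lemma the parent α of q is a parent of s and the parent β of r is
  -- a parent of p, so α ≠ β would give the C₆ α q p β r s.
  middle-shares-parent : ∀ {p q r s α β} → p ∈ A → q ∈ A → r ∈ A → s ∈ A →
    Adj G p q → Adj G q r → Adj G r s → p ≢ r → p ≢ s → q ≢ s →
    Parent α q → Parent β r → α ≡ β
  middle-shares-parent {p} {q} {r} {s} {α} {β} p∈A q∈A r∈A s∈A pq qr rs p≢r p≢s q≢s
                       (xα , αq) (xβ , βr) =
    decidable-stable (α ≟ β) λ α≢β → noC6 (cycle⇒C6 G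
      ( (N[x]∉A xα q∈A ∷ N[x]∉A xα p∈A ∷ α≢β ∷ N[x]∉A xα r∈A ∷ N[x]∉A xα s∈A ∷ [])
      ∷ (≢-sym (adj-irrefl G pq) ∷ ≢-sym (N[x]∉A xβ q∈A) ∷ adj-irrefl G qr ∷ q≢s ∷ [])
      ∷ (≢-sym (N[x]∉A xβ p∈A) ∷ p≢r ∷ p≢s ∷ [])
      ∷ (N[x]∉A xβ r∈A ∷ N[x]∉A xβ s∈A ∷ [])
      ∷ (adj-irrefl G rs ∷ [])
      ∷ [] ∷ [])
      αq (adj-sym G pq) (adj-sym G βp) βr rs (adj-sym G αs))
    where
    α-parent-of-s : Parent α s
    α-parent-of-s with parent-exists s∈A
    ... | δ , δs = subst (λ z → Parent z s)
                         (≡.sym (ends-share-parent q∈A r∈A s∈A qr rs q≢s (xα , αq) δs)) δs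
    αs : Adj G α s
    αs = proj₂ α-parent-of-s
    βp : Adj G β p
    βp with parent-exists p∈A
    ... | ε , εp = subst (λ z → Adj G z p)
                         (ends-share-parent p∈A q∈A r∈A pq qr p≢r εp (xβ , βr)) (proj₂ εp)

  -- A P₃-end u, on a path u–m–t, has a single parent: each of its parents is that of t.
  P3End⇒unique-parent : ∀ {u y y'} → u ∈ A → P3End G A u → Parent y u → Parent y' u → y ≡ y'
  P3End⇒unique-parent u∈A (m , t , m∈A , t∈A , um , mt , t≢u) yu y'u with parent-exists t∈A
  ... | z , zt = trans (ends-share-parent u∈A m∈A t∈A um mt (≢-sym t≢u) yu zt)
                       (≡.sym (ends-share-parent u∈A m∈A t∈A um mt (≢-sym t≢u) y'u zt))

  OtherNbr : Fin n → Fin n → Set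
  OtherNbr u v = ∃ λ s → s ∈ A × Adj G u s × s ≢ v

  OtherNbr? : ∀ u v → Dec (OtherNbr u v)
  OtherNbr? u v = any? λ s → (s ∈? A) ×-dec T? (adj G u s) ×-dec ¬? (s ≟ v)

  -- If v is the only neighbour of u in A, a path v–m–t extends to the path
  -- u–v–m–t: its ends u, m and its middle v, m give parent(u) = parent(v).
  pendant-edge-shares-parent : ∀ {u v y y'} → u ∈ A → v ∈ A → Adj G u v → ¬ OtherNbr u v →
    P3End G A v → Parent y u → Parent y' v → y ≡ y'
  pendant-edge-shares-parent {u} {v} u∈A v∈A uv none (m , t , m∈A , t∈A , vm , mt , t≢v) yu y'v
    with parent-exists m∈A
  ... | z , zm = trans (ends-share-parent u∈A v∈A m∈A uv vm u≢m yu zm)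
                       (≡.sym (middle-shares-parent u∈A v∈A m∈A t∈A uv vm mt u≢m u≢t (≢-sym t≢v) y'v zm))
    where
    only-v : ∀ {s} → s ∈ A → Adj G u s → s ≡ v
    only-v {s} s∈A us = decidable-stable (s ≟ v) λ s≢v → none (s , s∈A , us , s≢v)

    u≢m : u ≢ m
    u≢m refl = t≢v (only-v t∈A mt)

    u≢t : u ≢ t
    u≢t refl = adj-irrefl G vm (≡.sym (only-v m∈A (adj-sym G mt)))

  -- Adjacent P₃-ends share their parent.  If both have a further neighbour in A
  -- they lie on a triangle u s v or in the middle of a path s u v s'; otherwise
  -- the edge is pendant.
  edge-shares-parent : ∀ {u v y y'} → u ∈ A → v ∈ A → Adj G u v → P3End G A u → P3End G A v →
    Parent y u → Parent y' v → y ≡ y'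
  edge-shares-parent {u} {v} u∈A v∈A uv u-end v-end yu y'v with OtherNbr? u v | OtherNbr? v u
  ... | no none | _ = pendant-edge-shares-parent u∈A v∈A uv none v-end yu y'v
  ... | yes _ | no none = ≡.sym (pendant-edge-shares-parent v∈A u∈A (adj-sym G uv) none u-end y'v yu)
  ... | yes (s , s∈A , us , s≢v) | yes (s' , s'∈A , vs' , s'≢u) with s ≟ s'
  ...   | yes refl = ends-share-parent u∈A s∈A v∈A us (adj-sym G vs') (adj-irrefl G uv) yu y'v
  ...   | no s≢s' = middle-shares-parent s∈A u∈A v∈A s'∈A (adj-sym G us) uv vs'
                                         s≢v s≢s' (≢-sym s'≢u) yu y'v

  walk-shares-parent : (∀ v → v ∈ A → P3End G A v) →
    ∀ {a b y y'} → WalkIn G A a b → Parent y a → Parent y' b → y ≡ y'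
  walk-shares-parent all-ends (here a∈A) ya y'a = P3End⇒unique-parent a∈A (all-ends _ a∈A) ya y'a
  walk-shares-parent all-ends (step a∈A aw walk) ya y'b with parent-exists (walk-start G walk)
  ... | z , zw = trans (edge-shares-parent a∈A w∈A aw (all-ends _ a∈A) (all-ends _ w∈A) ya zw)
                       (walk-shares-parent all-ends walk zw y'b)
    where
    w∈A = walk-start G walk

  NxNA-subsingleton : (∀ u v → u ∈ A → v ∈ A → WalkIn G A u v) → (∀ v → v ∈ A → P3End G A v) →
    ∀ {y y'} → y ∈ NxNA G x A → y' ∈ NxNA G x A → y ≡ y'
  NxNA-subsingleton conn all-ends y∈ y'∈ with NxNA⇒parent y∈ | NxNA⇒parent y'∈
  ... | a , a∈A , ya | b , b∈A , y'b = walk-shares-parent all-ends (conn a b a∈A b∈A) ya y'b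

module Star {n : ℕ} (G : Graph n) (A : Subset n)
            (conn : ∀ u v → u ∈ A → v ∈ A → WalkIn G A u v)
            {v : Fin n} (v∈A : v ∈ A) (v-not-end : ¬ P3End G A v) where

  leaf : ∀ {u t} → u ∈ A → t ∈ A → Adj G v u → Adj G u t → t ≡ v
  leaf {u} {t} u∈A t∈A vu ut =
    decidable-stable (t ≟ v) λ t≢v → v-not-end (u , t , u∈A , t∈A , vu , ut , t≢v)

  Closed : Fin n → Set
  Closed z = z ≡ v ⊎ Adj G v z

  walk-stays-closed : ∀ {p z} → WalkIn G A p z → Closed p → Closed z
  walk-stays-closed (here _) c = c
  walk-stays-closed (step _ pq walk) (inj₁ refl) = walk-stays-closed walk (inj₂ pq)
  walk-stays-closed (step p∈A pq walk) (inj₂ vp) =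
    walk-stays-closed walk (inj₁ (leaf p∈A (walk-start G walk) vp pq))

  closed-nbhd : ∀ {z} → z ∈ A → Closed z
  closed-nbhd z∈A = walk-stays-closed (conn v _ v∈A z∈A) (inj₁ refl)

  IsLeaf : Fin n → Set
  IsLeaf u = u ∈ A × Adj G v u

  IsLeaf? : ∀ u → Dec (IsLeaf u)
  IsLeaf? u = (u ∈? A) ×-dec T? (adj G v u)

  leaves : List (Fin n)
  leaves = filter IsLeaf? (allFin n)

  leaf-at : ∀ i → IsLeaf (List.lookup leaves i)
  leaf-at i = proj₂ (∈-filter⁻ IsLeaf? {xs = allFin n} (∈-lookup i))

  vertex : Fin (Nat.suc (length leaves)) → Fin n
  vertex zero = v
  vertex (suc i) = List.lookup leaves i

  vertex∈A : ∀ i → vertex i ∈ A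
  vertex∈A zero = v∈A
  vertex∈A (suc i) = proj₁ (leaf-at i)

  vertex-injective : ∀ i j → vertex i ≡ vertex j → i ≡ j
  vertex-injective zero zero _ = refl
  vertex-injective zero (suc j) e = ⊥-elim (adj-irrefl G (proj₂ (leaf-at j)) e)
  vertex-injective (suc i) zero e = ⊥-elim (adj-irrefl G (proj₂ (leaf-at i)) (≡.sym e))
  vertex-injective (suc i) (suc j) e =
    cong suc (lookup-injective (filter⁺ IsLeaf? (allFin⁺ n)) i j e)

  vertex-surjective : ∀ z → z ∈ A → ∃ λ i → vertex i ≡ z
  vertex-surjective z z∈A with closed-nbhd z∈A
  ... | inj₁ refl = zero , refl
  ... | inj₂ vz = suc (Any.index z∈leaves) , ≡.sym (lookup-index z∈leaves)
    where
    z∈leaves : z ∈ˡ leaves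
    z∈leaves = ∈-filter⁺ IsLeaf? (∈-allFin z) (z∈A , vz)

  -- Two leaves are never adjacent, since a leaf has no neighbour besides v.
  vertex-adj : ∀ i j → (Adj G (vertex i) (vertex j) → StarAdj i j) × (StarAdj i j → Adj G (vertex i) (vertex j))
  vertex-adj zero zero = (λ vv → ⊥-elim (adj-irrefl G vv refl))
                       , λ { (inj₁ (_ , j≢0)) → ⊥-elim (j≢0 refl) ; (inj₂ (_ , i≢0)) → ⊥-elim (i≢0 refl) }
  vertex-adj zero (suc j) = (λ _ → inj₁ (refl , λ ())) , λ _ → proj₂ (leaf-at j)
  vertex-adj (suc i) zero = (λ _ → inj₂ (refl , λ ())) , λ _ → adj-sym G (proj₂ (leaf-at i))
  vertex-adj (suc i) (suc j) =
      (λ ij → ⊥-elim (adj-irrefl G (proj₂ (leaf-at j))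
                       (≡.sym (leaf (proj₁ (leaf-at i)) (proj₁ (leaf-at j)) (proj₂ (leaf-at i)) ij))))
    , λ { (inj₁ (() , _)) ; (inj₂ (() , _)) }

  star : ∀ {a b} → a ∈ A → b ∈ A → a ≢ b → Σ ℕ λ r → r ≥ 1 × InducedIsoStar G A r
  star {a} {b} a∈A b∈A a≢b =
    length leaves , has-leaf , vertex , vertex∈A , vertex-injective , vertex-surjective , vertex-adj
    where
    leaf-other-than-v : ∀ {c} → c ∈ A → c ≢ v → IsLeaf c
    leaf-other-than-v c∈A c≢v with closed-nbhd c∈A
    ... | inj₁ c≡v = ⊥-elim (c≢v c≡v)
    ... | inj₂ vc = c∈A , vc

    some-leaf : ∃ IsLeaf
    some-leaf with a ≟ v
    ... | yes refl = b , leaf-other-than-v b∈A (≢-sym a≢b)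
    ... | no a≢v = a , leaf-other-than-v a∈A a≢v

    nonempty : ∀ {c : Fin n} {xs} → c ∈ˡ xs → length xs ≥ 1
    nonempty {xs = _ ∷ _} _ = s≤s z≤n

    has-leaf : length leaves ≥ 1
    has-leaf = nonempty (∈-filter⁺ IsLeaf? (∈-allFin _) (proj₂ some-leaf))

corollary1 : (n : ℕ) (G : Graph n) → ¬ ContainsC6 G →
    (x : Fin n) (A : Subset n) → IsComponentN2 G x A →
    (∣ A ∣ ≡ 1) ⊎ (∣ NxNA G x A ∣ ≡ 1) ⊎ (Σ ℕ λ r → r ≥ 1 × InducedIsoStar G A r)
corollary1 n G noC6 x A ((a , a∈A) , A⊆N₂ , conn , _) with singleton-or-other A a∈A
... | inj₁ |A|≡1 = inj₁ |A|≡1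
... | inj₂ (b , b∈A , b≢a) = inj₂ one-parent-or-star
  where
  open Parents G noC6 x A A⊆N₂

  one-parent-or-star : ∣ NxNA G x A ∣ ≡ 1 ⊎ Σ ℕ λ r → r ≥ 1 × InducedIsoStar G A r
  one-parent-or-star with any? (λ v → (v ∈? A) ×-dec ¬? (P3End? G A v))
  ... | yes (v , v∈A , v-not-end) = inj₂ (Star.star G A conn v∈A v-not-end a∈A b∈A (≢-sym b≢a))
  ... | no none with parent-exists a∈A
  ...   | w , wa with singleton-or-other (NxNA G x A) (parent∈NxNA a∈A wa)
  ...     | inj₁ |NxNA|≡1 = inj₁ |NxNA|≡1
  ...     | inj₂ (y , y∈ , y≢w) = ⊥-elim (y≢w (NxNA-subsingleton conn all-ends y∈ (parent∈NxNA a∈A wa)))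
    where
    all-ends : ∀ v → v ∈ A → P3End G A v
    all-ends v v∈A = decidable-stable (P3End? G A v) λ v-not-end → none (v , v∈A , v-not-end)
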